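{- Let $G$ and $H$ be connected graphs with $\mathrm{oh}(G)=s$ and $\mathrm{oh}(H)=t$. Let $S_1,\dots,S_s$ be pairwise vertex-disjoint trees in $G$ and $c_G\colon V(G)\to\{1,2\}$ a 2-colouring that is proper on each $S_i$, such that for every $i\neq i'$ there is an edge of $G$ between $V(S_i)$ and $V(S_{i'})$ whose endpoints have the same $c_G$-colour. Let $T_1,\dots,T_t$ be pairwise vertex-disjoint trees in $H$ and $c_H\colon V(H)\to\{1,2\}$ a 2-colouring that is proper on each $T_j$, such that for every $j\neq j'$ there is an edge of $H$ between $V(T_j)$ and $V(T_{j'})$ whose endpoints have the same $c_H$-colour. For each $i\in[s]$, $j\in[t]$ let $\mathscr{T}_{ij}$ be a spanning tree of the subgraph $S_i\square T_j$ of $G\square H$. Define $c_1$ on $\bigcup_{i,j}V(\mathscr{T}_{ij})$ by $c_1((u,v))=1$ if $c_G(u)=c_H(v)$ and $c_1((u,v))=2$ otherwise. Then $c_1$ is a proper colouring of $\mathscr{T}_{ij}$ for all $i\in[s]$, $j\in[t]$; furthermore, for any distinct $(i,j),(i',j')\in[s]\times[t]$ with $i=i'$ or $j=j'$, there is an edge of $G\square H$ between $V(\mathscr{T}_{ij})$ and $V(\mathscr{T}_{i'j'})$ whose endpoints have the same $c_1$-colour.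
   Context: All graphs are finite, simple and loopless. $\mathrm{oh}(G)$ (Odd Hadwiger number) is the largest integer $m$ for which there exist $m$ pairwise vertex-disjoint trees $Z_1,\dots,Z_m$ in $G$ and a 2-colouring $c$ of $V(Z_1)\cup\dots\cup V(Z_m)$ that is proper on each $Z_k$, such that for every $k\neq k'$ there is an edge $xy\in E(G)$ with $x\in V(Z_k)$, $y\in V(Z_{k'})$, $c(x)=c(y)$. The Cartesian product $G\square H$ has vertex set $V(G)\times V(H)$, with $(v_1,u_1)\sim(v_2,u_2)$ iff ($v_1=v_2$ and $u_1u_2\in E(H)$) or ($u_1=u_2$ and $v_1v_2\in E(G)$); for subgraphs $S\subseteq G$, $T\subseteq H$, $S\square T$ is the corresponding subgraph of $G\square H$. $[n]=\{1,\dots,n\}$. -}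

module Defs where

open import Data.Nat using (ℕ; _≤_)
open import Data.Fin using (Fin; zero; suc; _≟_)
open import Data.List using (List; []; _∷_; length)
open import Data.List.Relation.Unary.Unique.Propositional using (Unique)
open import Data.Product using (Σ; ∃; _×_; _,_)
open import Data.Sum using (_⊎_)
open import Data.Empty using (⊥)
open import Data.Unit using (⊤)
open import Data.Bool using (if_then_else_)
open import Relation.Nullary using (¬_; does)
open import Relation.Binary.PropositionalEquality using (_≡_; _≢_)
open import Function.Bundles using (_↔_)

record Graph : Set₁ where
  field
    V      : Set
    Adj    : V → V → Set
    sym    : ∀ {x y} → Adj x y → Adj y x
    irrefl : ∀ {x} → ¬ Adj x x
    size   : ℕ
    finite : V ↔ Fin size
open Graph public

-- Walks: a list of successive vertices after the start, each related to the previous.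
ChainFrom : {V : Set} → (V → V → Set) → V → List V → Set
ChainFrom R x []       = ⊤
ChainFrom R x (y ∷ ys) = R x y × ChainFrom R y ys

lastOf : {V : Set} → V → List V → V
lastOf x []       = x
lastOf x (y ∷ ys) = lastOf y ys

Reachable : {V : Set} → (V → V → Set) → V → V → Set
Reachable {V} R x y = Σ (List V) λ rest → ChainFrom R x rest × lastOf x rest ≡ y

HasCycle : {V : Set} → (V → V → Set) → Set
HasCycle {V} R = Σ V λ v → Σ (List V) λ rest →
  (2 ≤ length rest) × Unique (v ∷ rest) × ChainFrom R v rest × R (lastOf v rest) v

Connected : Graph → Set
Connected G = V G × (∀ x y → Reachable (Adj G) x y)

record Subgraph {V : Set} (Adj : V → V → Set) : Set₁ where
  field
    Vtx     : V → Set
    Edg     : V → V → Set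
    edg-sym : ∀ {x y} → Edg x y → Edg y x
    edg-adj : ∀ {x y} → Edg x y → Adj x y
    edg-vtx : ∀ {x y} → Edg x y → Vtx x × Vtx y
open Subgraph public

IsTree : {V : Set} {Adj : V → V → Set} → Subgraph Adj → Set
IsTree {V} S = Σ V (Vtx S)
  × (∀ x y → Vtx S x → Vtx S y → Reachable (Edg S) x y)
  × ¬ HasCycle (Edg S)

Disjoint : {V : Set} {Adj : V → V → Set} → Subgraph Adj → Subgraph Adj → Set
Disjoint {V} S T = ∀ (x : V) → Vtx S x → Vtx T x → ⊥

ProperOn : {V : Set} {Adj : V → V → Set} → (V → Fin 2) → Subgraph Adj → Set
ProperOn c S = ∀ x y → Edg S x y → c x ≢ c y

MonoEdgeBetween : {V : Set} (Adj : V → V → Set) → (V → Fin 2) → Subgraph Adj → Subgraph Adj → Set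
MonoEdgeBetween {V} Adj c S T =
  Σ V λ x → Σ V λ y → Vtx S x × Vtx T y × Adj x y × c x ≡ c y

-- An odd clique minor model of size m (trees Z_1..Z_m, colouring c).
IsOddModel : (G : Graph) (m : ℕ) → (Fin m → Subgraph (Adj G)) → (V G → Fin 2) → Set
IsOddModel G m Z c =
    (∀ k → IsTree (Z k))
  × (∀ k k' → k ≢ k' → Disjoint (Z k) (Z k'))
  × (∀ k → ProperOn c (Z k))
  × (∀ k k' → k ≢ k' → MonoEdgeBetween (Adj G) c (Z k) (Z k'))

HasOddModel : Graph → ℕ → Set₁
HasOddModel G m = Σ (Fin m → Subgraph (Adj G)) λ Z → Σ (V G → Fin 2) λ c → IsOddModel G m Z c

OhIs : Graph → ℕ → Set₁
OhIs G s = HasOddModel G s × (∀ m → HasOddModel G m → m ≤ s)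

_□_ : (G H : Graph) → V G × V H → V G × V H → Set
(G □ H) (v₁ , u₁) (v₂ , u₂) = (v₁ ≡ v₂ × Adj H u₁ u₂) ⊎ (u₁ ≡ u₂ × Adj G v₁ v₂)

module _ (G H : Graph) (S : Subgraph (Adj G)) (T : Subgraph (Adj H)) where
  open import Data.Sum using (inj₁; inj₂)
  open import Relation.Binary.PropositionalEquality using (refl)

  ProdVtx : V G × V H → Set
  ProdVtx (v , u) = Vtx S v × Vtx T u

  ProdEdg : V G × V H → V G × V H → Set
  ProdEdg (v₁ , u₁) (v₂ , u₂) =
    (v₁ ≡ v₂ × Vtx S v₁ × Edg T u₁ u₂) ⊎ (u₁ ≡ u₂ × Vtx T u₁ × Edg S v₁ v₂)

  private
    es : ∀ {x y} → ProdEdg x y → ProdEdg y x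
    es {v₁ , u₁} {.v₁ , u₂} (inj₁ (refl , s , e)) = inj₁ (refl , s , edg-sym T e)
    es {v₁ , u₁} {v₂ , .u₁} (inj₂ (refl , t , e)) = inj₂ (refl , t , edg-sym S e)
    ea : ∀ {x y} → ProdEdg x y → (G □ H) x y
    ea {v₁ , u₁} {.v₁ , u₂} (inj₁ (refl , s , e)) = inj₁ (refl , edg-adj T e)
    ea {v₁ , u₁} {v₂ , .u₁} (inj₂ (refl , t , e)) = inj₂ (refl , edg-adj S e)
    ev : ∀ {x y} → ProdEdg x y → ProdVtx x × ProdVtx y
    ev {v₁ , u₁} {.v₁ , u₂} (inj₁ (refl , s , e)) with edg-vtx T e
    ... | a , b = (s , a) , (s , b)
    ev {v₁ , u₁} {v₂ , .u₁} (inj₂ (refl , t , e)) with edg-vtx S e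
    ... | a , b = (a , t) , (b , t)

  SubProd : Subgraph (G □ H)
  SubProd = record { Vtx = ProdVtx ; Edg = ProdEdg ; edg-sym = es ; edg-adj = ea ; edg-vtx = ev }

IsSpanningTreeOf : {V : Set} {Adj : V → V → Set} → Subgraph Adj → Subgraph Adj → Set
IsSpanningTreeOf {V} 𝒯 K =
    (∀ x → Vtx 𝒯 x → Vtx K x) × (∀ x → Vtx K x → Vtx 𝒯 x)
  × (∀ x y → Edg 𝒯 x y → Edg K x y)
  × IsTree 𝒯

-- c₁((u,v)) = 1 if c_G(u) = c_H(v), and 2 otherwise (colours 1,2 encoded as 0,1 in Fin 2)
c₁ : {A B : Set} → (A → Fin 2) → (B → Fin 2) → A × B → Fin 2
c₁ cG cH (u , v) = if does (cG u ≟ cH v) then zero else suc zero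

{-# OPTIONS --safe #-}
-- c₁ (u , v) records whether cG u and cH v agree, which for either coordinate fixed is a
-- bijection of the two colours.  An edge of S i □ T j fixes one coordinate and moves the other
-- along an edge of S i or T j, where cG resp. cH changes, so c₁ changes too.  A monochromatic
-- edge between T j and T j' (resp. S i and S i') lifts, at any vertex of S i (resp. T j), to a
-- monochromatic edge of G □ H.
module Submission where

open import Defs
open import Data.Nat using (ℕ)
open import Data.Fin using (Fin; zero; suc)
open import Data.Product using (Σ; _×_; _,_; proj₁)
open import Data.Sum using (_⊎_; inj₁; inj₂)
open import Function using (id; _∘_)
open import Function.Definitions using (Injective)
open import Relation.Binary.PropositionalEquality
  using (_≡_; _≢_; refl; trans; cong; module ≡-Reasoning)

agree : Fin 2 → Fin 2 → Fin 2
agree a b = c₁ id id (a , b)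

agree-involutive : ∀ a b → agree a (agree a b) ≡ b
agree-involutive zero       zero       = refl
agree-involutive zero       (suc zero) = refl
agree-involutive (suc zero) zero       = refl
agree-involutive (suc zero) (suc zero) = refl

agree-comm : ∀ a b → agree a b ≡ agree b a
agree-comm zero       zero       = refl
agree-comm zero       (suc zero) = refl
agree-comm (suc zero) zero       = refl
agree-comm (suc zero) (suc zero) = refl

agree-injectiveʳ : ∀ a → Injective _≡_ _≡_ (agree a)
agree-injectiveʳ a {b} {b'} eq = begin
  b                    ≡⟨ agree-involutive a b ⟨
  agree a (agree a b)  ≡⟨ cong (agree a) eq ⟩
  agree a (agree a b') ≡⟨ agree-involutive a b' ⟩
  b'                   ∎
  where open ≡-Reasoning

agree-injectiveˡ : ∀ b → Injective _≡_ _≡_ (λ a → agree a b)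
agree-injectiveˡ b {a} {a'} eq =
  agree-injectiveʳ b (trans (agree-comm b a) (trans eq (agree-comm a' b)))

-- Subgraphs are passed explicitly throughout: ProperOn, MonoEdgeBetween and IsSpanningTreeOf
-- unfold to statements about Vtx and Edg, from which Agda cannot recover the subgraph.
module _ {V : Set} {Adj : V → V → Set} where

  ProperOn-spanning : {c : V → Fin 2} (𝒯 K : Subgraph Adj) →
                      IsSpanningTreeOf 𝒯 K → ProperOn c K → ProperOn c 𝒯
  ProperOn-spanning _ _ (_ , _ , 𝒯⊆K , _) properK x y = properK x y ∘ 𝒯⊆K x y

  MonoEdgeBetween-spanning : {c : V → Fin 2} (𝒯 𝒯' K K' : Subgraph Adj) →
                             IsSpanningTreeOf 𝒯 K → IsSpanningTreeOf 𝒯' K' →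
                             MonoEdgeBetween Adj c K K' → MonoEdgeBetween Adj c 𝒯 𝒯'
  MonoEdgeBetween-spanning _ _ _ _ (_ , K⊆𝒯 , _) (_ , K'⊆𝒯' , _)
                           (x , y , x∈K , y∈K' , xy , cx≡cy) =
    x , y , K⊆𝒯 x x∈K , K'⊆𝒯' y y∈K' , xy , cx≡cy

module ProductColouring (G H : Graph) (cG : V G → Fin 2) (cH : V H → Fin 2) where

  SubProd-proper : (S : Subgraph (Adj G)) (T : Subgraph (Adj H)) →
                   ProperOn cG S → ProperOn cH T → ProperOn (c₁ cG cH) (SubProd G H S T)
  SubProd-proper _ _ _       properT (v , u₁) (.v , u₂) (inj₁ (refl , _ , u₁u₂)) =
    properT u₁ u₂ u₁u₂ ∘ agree-injectiveʳ (cG v)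
  SubProd-proper _ _ properS _       (v₁ , u) (v₂ , .u) (inj₂ (refl , _ , v₁v₂)) =
    properS v₁ v₂ v₁v₂ ∘ agree-injectiveˡ (cH u)

  SubProd-monoʳ : (S : Subgraph (Adj G)) (T T' : Subgraph (Adj H)) → Σ (V G) (Vtx S) →
                  MonoEdgeBetween (Adj H) cH T T' →
                  MonoEdgeBetween (G □ H) (c₁ cG cH) (SubProd G H S T) (SubProd G H S T')
  SubProd-monoʳ _ _ _ (v , v∈S) (u , u' , u∈T , u'∈T' , uu' , cu≡cu') =
    (v , u) , (v , u') , (v∈S , u∈T) , (v∈S , u'∈T') , inj₁ (refl , uu') ,
    cong (agree (cG v)) cu≡cu'

  SubProd-monoˡ : (S S' : Subgraph (Adj G)) (T : Subgraph (Adj H)) → Σ (V H) (Vtx T) →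
                  MonoEdgeBetween (Adj G) cG S S' →
                  MonoEdgeBetween (G □ H) (c₁ cG cH) (SubProd G H S T) (SubProd G H S' T)
  SubProd-monoˡ _ _ _ (u , u∈T) (v , v' , v∈S , v'∈S' , vv' , cv≡cv') =
    (v , u) , (v' , u) , (v∈S , u∈T) , (v'∈S' , u∈T) , inj₂ (refl , vv') ,
    cong (λ a → agree a (cH u)) cv≡cv'

lemma6 : (G H : Graph) → Connected G → Connected H → (s t : ℕ) → OhIs G s → OhIs H t
    → (S : Fin s → Subgraph (Adj G)) → (cG : V G → Fin 2) → IsOddModel G s S cG
    → (T : Fin t → Subgraph (Adj H)) → (cH : V H → Fin 2) → IsOddModel H t T cH
    → (𝒯 : Fin s → Fin t → Subgraph (G □ H))
    → (∀ i j → IsSpanningTreeOf (𝒯 i j) (SubProd G H (S i) (T j)))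
    → (∀ i j → ProperOn (c₁ cG cH) (𝒯 i j))
      × (∀ i j i' j' → (i , j) ≢ (i' , j') → (i ≡ i' ⊎ j ≡ j')
          → MonoEdgeBetween (G □ H) (c₁ cG cH) (𝒯 i j) (𝒯 i' j'))
lemma6 G H _ _ s t _ _ S cG (treeS , _ , properS , monoS) T cH (treeT , _ , properT , monoT)
       𝒯 spanning =
  proper , mono
  where
  open ProductColouring G H cG cH

  S□T : Fin s → Fin t → Subgraph (G □ H)
  S□T i j = SubProd G H (S i) (T j)

  proper : ∀ i j → ProperOn (c₁ cG cH) (𝒯 i j)
  proper i j = ProperOn-spanning (𝒯 i j) (S□T i j) (spanning i j)
    (SubProd-proper (S i) (T j) (properS i) (properT j))

  mono : ∀ i j i' j' → (i , j) ≢ (i' , j') → (i ≡ i' ⊎ j ≡ j')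
       → MonoEdgeBetween (G □ H) (c₁ cG cH) (𝒯 i j) (𝒯 i' j')
  mono i j .i j' ij≢ij' (inj₁ refl) =
    MonoEdgeBetween-spanning (𝒯 i j) (𝒯 i j') (S□T i j) (S□T i j')
      (spanning i j) (spanning i j')
      (SubProd-monoʳ (S i) (T j) (T j') (proj₁ (treeS i))
        (monoT j j' (ij≢ij' ∘ cong (i ,_))))
  mono i j i' .j ij≢ij' (inj₂ refl) =
    MonoEdgeBetween-spanning (𝒯 i j) (𝒯 i' j) (S□T i j) (S□T i' j)
      (spanning i j) (spanning i' j)
      (SubProd-monoˡ (S i) (S i') (T j) (proj₁ (treeT j))
        (monoS i i' (ij≢ij' ∘ cong (_, j))))
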